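{- For all positive integers $k,n$, $$\langle 1\rangle_{n,\lambda}+\langle 2\rangle_{n,\lambda}+\cdots+\langle k\rangle_{n,\lambda}=\sum_{l=1}^{n}H_{\lambda}(n,l)\,l!\binom{k+1}{l+1}.$$
   Context: Fix a nonzero real $\lambda$. Put $\langle x\rangle_{0,\lambda}=1$, $\langle x\rangle_{n,\lambda}=x(x+\lambda)\cdots(x+(n-1)\lambda)$ for $n\ge1$. The heterogeneous Stirling numbers of the second kind $H_\lambda(n,k)$ are defined by $\langle x\rangle_{n,\lambda}=\sum_{k=0}^{n}H_{\lambda}(n,k)(x)_{k}$, where $(x)_0=1$, $(x)_k=x(x-1)\cdots(x-k+1)$; equivalently $\frac{1}{k!}((1-\lambda t)^{ -1/\lambda}-1)^{k}=\sum_{n\ge k}H_{\lambda}(n,k)\frac{t^{n}}{n!}$. -}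

module Defs where

open import Algebra.Bundles using (CommutativeRing)
open import Data.Nat using (ℕ; zero; suc)
open import Level using (_⊔_)

-- Generic definitions over an arbitrary commutative ring R
-- (the paper's setting is R = ℝ).
module RingDefs {c ℓ} (R : CommutativeRing c ℓ) where
  open CommutativeRing R

  fromℕ : ℕ → Carrier
  fromℕ zero    = 0#
  fromℕ (suc n) = 1# + fromℕ n

  ∑ : ℕ → (ℕ → Carrier) → Carrier
  ∑ zero    f = 0#
  ∑ (suc n) f = ∑ n f + f n

  risingλ : Carrier → Carrier → ℕ → Carrier
  risingλ lam x zero    = 1#
  risingλ lam x (suc n) = risingλ lam x n * (x + fromℕ n * lam)

  falling : Carrier → ℕ → Carrier
  falling x zero    = 1#
  falling x (suc k) = falling x k * (x - fromℕ k)

  -- H is a family of heterogeneous Stirling numbers of the second kind for λ: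
  -- ⟨x⟩_{n,λ} = ∑_{k=0}^{n} H(n,k) (x)_k  for all x and n.
  IsHeteroStirling2 : Carrier → (ℕ → ℕ → Carrier) → Set (c ⊔ ℓ)
  IsHeteroStirling2 lam H =
    ∀ (n : ℕ) (x : Carrier) → risingλ lam x n ≈ ∑ (suc n) (λ k → H n k * falling x k)

{-# OPTIONS --safe #-}
-- Since ⟨x⟩_{n,λ} = ∑_l H(n,l) (x)_l, the left-hand side equals ∑_l H(n,l) ∑_{j=1}^k (j)_l.
-- At natural numbers (j)_l = l! C(j,l), so the hockey-stick identity gives ∑_{j=1}^k (j)_l = l! C(k+1,l+1)
-- for l ≥ 1, while the l = 0 term vanishes because H(n,0) = ⟨0⟩_{n,λ} = 0 for n ≥ 1.
module Submission where

open import Defs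
open import Algebra.Bundles using (CommutativeRing)
open import Data.Nat using (ℕ; zero; suc; _≤_; _!)
open import Data.Nat.Combinatorics using (_C_; nCk+nC[k+1]≡[n+1]C[k+1])
open import Relation.Nullary using (¬_)
import Data.Nat as ℕ
import Data.Nat.Properties as ℕₚ
open import Relation.Binary.PropositionalEquality as ≡ using (_≡_)
import Algebra.Properties.CommutativeSemigroup as CommutativeSemigroupProperties
import Algebra.Properties.AbelianGroup as AbelianGroupProperties
import Algebra.Properties.Semiring.Mult as SemiringMult

a*nC[k+1]+a*nCk≡a*[n+1]C[k+1] : ∀ a n k → a ℕ.* (n C suc k) ℕ.+ a ℕ.* (n C k) ≡ a ℕ.* (suc n C suc k)
a*nC[k+1]+a*nCk≡a*[n+1]C[k+1] a n k = begin
  a ℕ.* (n C suc k) ℕ.+ a ℕ.* (n C k) ≡⟨ ℕₚ.*-distribˡ-+ a (n C suc k) (n C k) ⟨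
  a ℕ.* (n C suc k ℕ.+ n C k)         ≡⟨ ≡.cong (a ℕ.*_) (ℕₚ.+-comm (n C suc k) (n C k)) ⟩
  a ℕ.* (n C k ℕ.+ n C suc k)         ≡⟨ ≡.cong (a ℕ.*_) (nCk+nC[k+1]≡[n+1]C[k+1] n k) ⟩
  a ℕ.* (suc n C suc k)               ∎
  where open ≡.≡-Reasoning

module _ {c ℓ} (R : CommutativeRing c ℓ) where
  open CommutativeRing R
  open RingDefs R
  open import Relation.Binary.Reasoning.Setoid setoid
  open CommutativeSemigroupProperties +-commutativeSemigroup using (interchange)
  open AbelianGroupProperties +-abelianGroup using (⁻¹-∙-comm; ε⁻¹≈ε)
  open SemiringMult semiring using (_×_; ×-homo-+; ×1-homo-*)

  fromℕ≡×1# : ∀ n → fromℕ n ≡ n × 1#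
  fromℕ≡×1# zero    = ≡.refl
  fromℕ≡×1# (suc n) = ≡.cong (1# +_) (fromℕ≡×1# n)

  fromℕ-homo-+ : ∀ m n → fromℕ (m ℕ.+ n) ≈ fromℕ m + fromℕ n
  fromℕ-homo-+ m n rewrite fromℕ≡×1# (m ℕ.+ n) | fromℕ≡×1# m | fromℕ≡×1# n = ×-homo-+ 1# m n

  fromℕ-homo-* : ∀ m n → fromℕ (m ℕ.* n) ≈ fromℕ m * fromℕ n
  fromℕ-homo-* m n rewrite fromℕ≡×1# (m ℕ.* n) | fromℕ≡×1# m | fromℕ≡×1# n = ×1-homo-* m n

  ∑-cong : ∀ n {f g : ℕ → Carrier} → (∀ i → f i ≈ g i) → ∑ n f ≈ ∑ n g
  ∑-cong zero    f≈g = refl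
  ∑-cong (suc n) f≈g = +-cong (∑-cong n f≈g) (f≈g n)

  ∑-0 : ∀ n → ∑ n (λ _ → 0#) ≈ 0#
  ∑-0 zero    = refl
  ∑-0 (suc n) = trans (+-identityʳ _) (∑-0 n)

  ∑-distrib-+ : ∀ n (f g : ℕ → Carrier) → ∑ n (λ i → f i + g i) ≈ ∑ n f + ∑ n g
  ∑-distrib-+ zero    f g = sym (+-identityˡ 0#)
  ∑-distrib-+ (suc n) f g = trans (+-congʳ (∑-distrib-+ n f g)) (interchange _ _ _ _)

  ∑-comm : ∀ m n (f : ℕ → ℕ → Carrier) →
           ∑ m (λ i → ∑ n (λ j → f i j)) ≈ ∑ n (λ j → ∑ m (λ i → f i j))
  ∑-comm zero    n f = sym (∑-0 n)
  ∑-comm (suc m) n f = trans (+-congʳ (∑-comm m n f)) (sym (∑-distrib-+ n _ _))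

  *-distribˡ-∑ : ∀ n x (f : ℕ → Carrier) → x * ∑ n f ≈ ∑ n (λ i → x * f i)
  *-distribˡ-∑ zero    x f = zeroʳ x
  *-distribˡ-∑ (suc n) x f = trans (distribˡ x _ _) (+-congʳ (*-distribˡ-∑ n x f))

  ∑-sucˡ : ∀ n (f : ℕ → Carrier) → ∑ (suc n) f ≈ f 0 + ∑ n (λ i → f (suc i))
  ∑-sucˡ zero    f = trans (+-identityˡ _) (sym (+-identityʳ _))
  ∑-sucˡ (suc n) f = trans (+-congʳ (∑-sucˡ n f)) (+-assoc _ _ _)

  [o+x]-[o+y]≈x-y : ∀ o x y → (o + x) - (o + y) ≈ x - y
  [o+x]-[o+y]≈x-y o x y = begin
    (o + x) + - (o + y)   ≈⟨ +-congˡ (⁻¹-∙-comm o y) ⟨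
    (o + x) + (- o + - y) ≈⟨ interchange o x (- o) (- y) ⟩
    (o + - o) + (x - y)   ≈⟨ +-congʳ (-‿inverseʳ o) ⟩
    0# + (x - y)          ≈⟨ +-identityˡ _ ⟩
    x - y                 ∎

  [x-y]+[o+y]≈o+x : ∀ o x y → (x - y) + (o + y) ≈ o + x
  [x-y]+[o+y]≈o+x o x y = begin
    (x + - y) + (o + y) ≈⟨ interchange x (- y) o y ⟩
    (x + o) + (- y + y) ≈⟨ +-congˡ (-‿inverseˡ y) ⟩
    (x + o) + 0#        ≈⟨ +-identityʳ _ ⟩
    x + o               ≈⟨ +-comm x o ⟩
    o + x               ∎

  falling[1+x] : ∀ x l → falling (1# + x) (suc l) ≈ (1# + x) * falling x l
  falling[1+x] x zero = begin
    1# * ((1# + x) - 0#) ≈⟨ *-identityˡ _ ⟩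
    (1# + x) - 0#        ≈⟨ +-congˡ ε⁻¹≈ε ⟩
    (1# + x) + 0#        ≈⟨ +-identityʳ _ ⟩
    1# + x               ≈⟨ *-identityʳ _ ⟨
    (1# + x) * 1#        ∎
  falling[1+x] x (suc l) = begin
    falling (1# + x) (suc l) * ((1# + x) - (1# + fromℕ l))
      ≈⟨ *-cong (falling[1+x] x l) ([o+x]-[o+y]≈x-y 1# x (fromℕ l)) ⟩
    ((1# + x) * falling x l) * (x - fromℕ l)
      ≈⟨ *-assoc _ _ _ ⟩
    (1# + x) * falling x (suc l) ∎

  falling-pascal : ∀ x l → falling (1# + x) (suc l) ≈ falling x (suc l) + fromℕ (suc l) * falling x l
  falling-pascal x l = begin
    falling (1# + x) (suc l)                  ≈⟨ falling[1+x] x l ⟩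
    (1# + x) * f                              ≈⟨ *-congʳ ([x-y]+[o+y]≈o+x 1# x (fromℕ l)) ⟨
    ((x - fromℕ l) + fromℕ (suc l)) * f       ≈⟨ distribʳ f _ _ ⟩
    (x - fromℕ l) * f + fromℕ (suc l) * f     ≈⟨ +-congʳ (*-comm _ f) ⟩
    falling x (suc l) + fromℕ (suc l) * f     ∎
    where f = falling x l

  falling-0# : ∀ l → falling 0# (suc l) ≈ 0#
  falling-0# zero    = trans (*-identityˡ _) (-‿inverseʳ 0#)
  falling-0# (suc l) = trans (*-congʳ (falling-0# l)) (zeroˡ _)

  falling-fromℕ : ∀ m l → falling (fromℕ m) l ≈ fromℕ (l ! ℕ.* (m C l))
  falling-fromℕ m       zero    = sym (+-identityʳ 1#)
  falling-fromℕ zero    (suc l) = trans (falling-0# l) (reflexive (≡.cong fromℕ (≡.sym (ℕₚ.*-zeroʳ (suc l !)))))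
  falling-fromℕ (suc m) (suc l) = begin
    falling (1# + fromℕ m) (suc l)
      ≈⟨ falling-pascal (fromℕ m) l ⟩
    falling (fromℕ m) (suc l) + fromℕ (suc l) * falling (fromℕ m) l
      ≈⟨ +-cong (falling-fromℕ m (suc l)) (*-congˡ (falling-fromℕ m l)) ⟩
    fromℕ (suc l ! ℕ.* (m C suc l)) + fromℕ (suc l) * fromℕ (l ! ℕ.* (m C l))
      ≈⟨ +-congˡ (fromℕ-homo-* (suc l) (l ! ℕ.* (m C l))) ⟨
    fromℕ (suc l ! ℕ.* (m C suc l)) + fromℕ (suc l ℕ.* (l ! ℕ.* (m C l)))
      ≈⟨ fromℕ-homo-+ (suc l ! ℕ.* (m C suc l)) (suc l ℕ.* (l ! ℕ.* (m C l))) ⟨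
    fromℕ (suc l ! ℕ.* (m C suc l) ℕ.+ suc l ℕ.* (l ! ℕ.* (m C l)))
      ≡⟨ ≡.cong (λ t → fromℕ (suc l ! ℕ.* (m C suc l) ℕ.+ t)) (ℕₚ.*-assoc (suc l) (l !) (m C l)) ⟨
    fromℕ (suc l ! ℕ.* (m C suc l) ℕ.+ suc l ! ℕ.* (m C l))
      ≡⟨ ≡.cong fromℕ (a*nC[k+1]+a*nCk≡a*[n+1]C[k+1] (suc l !) m l) ⟩
    fromℕ (suc l ! ℕ.* (suc m C suc l)) ∎

  ∑-falling-fromℕ : ∀ k l →
    ∑ k (λ j → falling (fromℕ (suc j)) (suc l)) ≈ fromℕ (suc l ! ℕ.* (suc k C suc (suc l)))
  ∑-falling-fromℕ zero    l = reflexive (≡.cong fromℕ (≡.sym (ℕₚ.*-zeroʳ (suc l !))))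
  ∑-falling-fromℕ (suc k) l = begin
    ∑ k (λ j → falling (fromℕ (suc j)) (suc l)) + falling (fromℕ (suc k)) (suc l)
      ≈⟨ +-cong (∑-falling-fromℕ k l) (falling-fromℕ (suc k) (suc l)) ⟩
    fromℕ (suc l ! ℕ.* (suc k C suc (suc l))) + fromℕ (suc l ! ℕ.* (suc k C suc l))
      ≈⟨ fromℕ-homo-+ (suc l ! ℕ.* (suc k C suc (suc l))) (suc l ! ℕ.* (suc k C suc l)) ⟨
    fromℕ (suc l ! ℕ.* (suc k C suc (suc l)) ℕ.+ suc l ! ℕ.* (suc k C suc l))
      ≡⟨ ≡.cong fromℕ (a*nC[k+1]+a*nCk≡a*[n+1]C[k+1] (suc l !) (suc k) (suc l)) ⟩
    fromℕ (suc l ! ℕ.* (suc (suc k) C suc (suc l))) ∎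

  risingλ-0# : ∀ lam n → risingλ lam 0# (suc n) ≈ 0#
  risingλ-0# lam zero    = trans (*-identityˡ _) (trans (+-identityˡ _) (zeroˡ lam))
  risingλ-0# lam (suc n) = trans (*-congʳ (risingλ-0# lam n)) (zeroˡ _)

  module _ {lam : Carrier} {H : ℕ → ℕ → Carrier} (isH : IsHeteroStirling2 lam H) where

    H[1+n,0]≈0 : ∀ n → H (suc n) 0 ≈ 0#
    H[1+n,0]≈0 n = begin
      H (suc n) 0
        ≈⟨ trans (+-identityʳ _) (*-identityʳ _) ⟨
      H (suc n) 0 * 1# + 0#
        ≈⟨ +-congˡ higher-terms-vanish ⟨
      H (suc n) 0 * 1# + ∑ (suc n) (λ i → H (suc n) (suc i) * falling 0# (suc i))
        ≈⟨ ∑-sucˡ (suc n) _ ⟨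
      ∑ (suc (suc n)) (λ l → H (suc n) l * falling 0# l)
        ≈⟨ isH (suc n) 0# ⟨
      risingλ lam 0# (suc n)
        ≈⟨ risingλ-0# lam n ⟩
      0# ∎
      where
      higher-terms-vanish : ∑ (suc n) (λ i → H (suc n) (suc i) * falling 0# (suc i)) ≈ 0#
      higher-terms-vanish = trans (∑-cong (suc n) (λ i → trans (*-congˡ (falling-0# i)) (zeroʳ _))) (∑-0 (suc n))

    ∑-risingλ-fromℕ : ∀ k n →
      ∑ k (λ j → risingλ lam (fromℕ (suc j)) (suc n))
        ≈ ∑ (suc n) (λ i → H (suc n) (suc i) * fromℕ (suc i !) * fromℕ (suc k C suc (suc i)))
    ∑-risingλ-fromℕ k n = begin
      ∑ k (λ j → risingλ lam (fromℕ (suc j)) (suc n))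
        ≈⟨ ∑-cong k (λ j → isH (suc n) (fromℕ (suc j))) ⟩
      ∑ k (λ j → ∑ (suc (suc n)) (λ l → H (suc n) l * falling (fromℕ (suc j)) l))
        ≈⟨ ∑-comm k (suc (suc n)) _ ⟩
      ∑ (suc (suc n)) (λ l → ∑ k (λ j → H (suc n) l * falling (fromℕ (suc j)) l))
        ≈⟨ ∑-cong (suc (suc n)) (λ l → *-distribˡ-∑ k (H (suc n) l) _) ⟨
      ∑ (suc (suc n)) (λ l → H (suc n) l * ∑ k (λ j → falling (fromℕ (suc j)) l))
        ≈⟨ ∑-sucˡ (suc n) _ ⟩
      H (suc n) 0 * ∑ k (λ j → falling (fromℕ (suc j)) 0)
        + ∑ (suc n) (λ i → H (suc n) (suc i) * ∑ k (λ j → falling (fromℕ (suc j)) (suc i)))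
        ≈⟨ +-cong (trans (*-congʳ (H[1+n,0]≈0 n)) (zeroˡ _)) (∑-cong (suc n) (λ i → *-congˡ (∑-falling-fromℕ k i))) ⟩
      0# + ∑ (suc n) (λ i → H (suc n) (suc i) * fromℕ (suc i ! ℕ.* (suc k C suc (suc i))))
        ≈⟨ +-identityˡ _ ⟩
      ∑ (suc n) (λ i → H (suc n) (suc i) * fromℕ (suc i ! ℕ.* (suc k C suc (suc i))))
        ≈⟨ ∑-cong (suc n) (λ i → trans (*-congˡ (fromℕ-homo-* (suc i !) _)) (sym (*-assoc _ _ _))) ⟩
      ∑ (suc n) (λ i → H (suc n) (suc i) * fromℕ (suc i !) * fromℕ (suc k C suc (suc i))) ∎

lemma2p19 : ∀ {c ℓ} (R : CommutativeRing c ℓ) →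
    let open CommutativeRing R
        open RingDefs R
    in
    (lam : Carrier) → ¬ (lam ≈ 0#) →
    (H : ℕ → ℕ → Carrier) → IsHeteroStirling2 lam H →
    (k n : ℕ) → 1 ≤ k → 1 ≤ n →
    ∑ k (λ j → risingλ lam (fromℕ (suc j)) n)
      ≈ ∑ n (λ i → H n (suc i) * fromℕ ((suc i) !) * fromℕ (suc k C suc (suc i)))
lemma2p19 R _ _ _ isH k (suc n) _ _ = ∑-risingλ-fromℕ R isH k n
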